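{- There exists a strictly $4$-sparse $4$-cycle system of order $9$.
   Context: A $4$-cycle is a cycle of length four, written $(a,b,c,d)$ with edges $\{a,b\},\{b,c\},\{c,d\},\{d,a\}$; its diagonals are the pairs $\{a,c\}$ and $\{b,d\}$. A $4$-cycle system of order $v$, $4\mathrm{CS}(v)$, is a pair $(V,\mathcal{C})$ where $V$ is the vertex set of $K_v$ and $\mathcal{C}$ is a collection of edge-disjoint $4$-cycles whose edges partition the edge set of $K_v$. A $(k,l)$-configuration in a $4$CS is a set of $l$ of its $4$-cycles whose union contains precisely $k$ vertices. A $4$CS is $r$-sparse if it contains no $(j+3,j)$-configuration for any integer $j$ with $2\le j\le r$. A double-diamond configuration is a pair of $4$-cycles of the form $(a,b,c,d)$ and $(a,e,c,f)$ (six distinct vertices), i.e. two $4$-cycles sharing a common diagonal. A $4$CS is $D$-avoiding if it contains no double-diamond configuration, and strictly $r$-sparse if it is both $r$-sparse and $D$-avoiding. -}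

module Defs where

open import Data.Nat using (ℕ; _+_; _≤_)
open import Data.Fin using (Fin)
open import Data.Fin.Properties using (_≟_)
open import Data.Fin.Subset using (Subset; ⁅_⁆; _∪_; ⋃; ∣_∣; _∈_; ⊥)
open import Data.Fin.Subset.Properties using (_∈?_)
open import Data.List using (List; []; _∷_; length; lookup; filter; concatMap; map)
open import Data.List.Relation.Unary.Any using (Any)
open import Data.Product using (_×_; _,_; ∃; ∃-syntax)
open import Data.Sum using (_⊎_)
open import Relation.Binary.PropositionalEquality using (_≡_; _≢_)
open import Relation.Nullary using (¬_; Dec)
open import Relation.Nullary.Decidable using (_×-dec_; _⊎-dec_)
open import Data.List using (allFin)

-- A 4-cycle (a,b,c,d) on vertex set Fin v: four pairwise distinct vertices,
-- edges {a,b},{b,c},{c,d},{d,a}; diagonals {a,c},{b,d}.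
record Cycle4 (v : ℕ) : Set where
  constructor cyc
  field
    a b c d : Fin v
    a≢b : a ≢ b
    a≢c : a ≢ c
    a≢d : a ≢ d
    b≢c : b ≢ c
    b≢d : b ≢ d
    c≢d : c ≢ d

open Cycle4 public

Edge : ℕ → Set
Edge v = Fin v × Fin v

-- the four edges of a 4-cycle (as ordered pairs; compared as unordered pairs)
edges : ∀ {v} → Cycle4 v → List (Edge v)
edges C = (a C , b C) ∷ (b C , c C) ∷ (c C , d C) ∷ (d C , a C) ∷ []

vertices : ∀ {v} → Cycle4 v → Subset v
vertices C = ⁅ a C ⁆ ∪ (⁅ b C ⁆ ∪ (⁅ c C ⁆ ∪ ⁅ d C ⁆))

SameEdge : ∀ {v} → Fin v → Fin v → Edge v → Set
SameEdge x y (p , q) = (p ≡ x × q ≡ y) ⊎ (p ≡ y × q ≡ x)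

sameEdge? : ∀ {v} (x y : Fin v) (e : Edge v) → Dec (SameEdge x y e)
sameEdge? x y (p , q) = ((p ≟ x) ×-dec (q ≟ y)) ⊎-dec ((p ≟ y) ×-dec (q ≟ x))

edgeMultiplicity : ∀ {v} → List (Cycle4 v) → Fin v → Fin v → ℕ
edgeMultiplicity 𝒞 x y = length (filter (sameEdge? x y) (concatMap edges 𝒞))

-- (Fin v , 𝒞) is a 4-cycle system of order v: the edges of the 4-cycles in 𝒞
-- partition the edge set of K_v, i.e. every edge {x,y} (x ≠ y) of K_v occurs
-- exactly once among the edges of the cycles of 𝒞 (counted with multiplicity).
Is4CS : (v : ℕ) → List (Cycle4 v) → Set
Is4CS v 𝒞 = ∀ (x y : Fin v) → x ≢ y → edgeMultiplicity 𝒞 x y ≡ 1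

unionVertices : ∀ {v} (𝒞 : List (Cycle4 v)) → Subset (length 𝒞) → Subset v
unionVertices 𝒞 S =
  ⋃ (map (λ i → vertices (lookup 𝒞 i)) (filter (λ i → i ∈? S) (allFin (length 𝒞))))

Configuration : ∀ {v} (𝒞 : List (Cycle4 v)) → ℕ → ℕ → Set
Configuration 𝒞 k l = ∃[ S ] (∣ S ∣ ≡ l × ∣ unionVertices 𝒞 S ∣ ≡ k)

Sparse : ∀ {v} → ℕ → List (Cycle4 v) → Set
Sparse r 𝒞 = ∀ j → 2 ≤ j → j ≤ r → ¬ Configuration 𝒞 (j + 3) j

-- cycle C is the 4-cycle (p,q,r,s): same cycle up to rotation/reflection
IsCycle : ∀ {v} → Cycle4 v → Fin v → Fin v → Fin v → Fin v → Set
IsCycle C p q r s = Any (λ t → t ≡ (a C , b C , c C , d C))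
  ( (p , q , r , s) ∷ (q , r , s , p) ∷ (r , s , p , q) ∷ (s , p , q , r)
  ∷ (p , s , r , q) ∷ (s , r , q , p) ∷ (r , q , p , s) ∷ (q , p , s , r) ∷ [])

DoubleDiamond : ∀ {v} → List (Cycle4 v) → Set
DoubleDiamond {v} 𝒞 = ∃[ i ] ∃[ j ] (i ≢ j × ∃[ x₁ ] ∃[ x₂ ] ∃[ x₃ ] ∃[ x₄ ] ∃[ x₅ ] ∃[ x₆ ]
  ( x₁ ≢ x₂ × x₁ ≢ x₃ × x₁ ≢ x₄ × x₁ ≢ x₅ × x₁ ≢ x₆
  × x₂ ≢ x₃ × x₂ ≢ x₄ × x₂ ≢ x₅ × x₂ ≢ x₆
  × x₃ ≢ x₄ × x₃ ≢ x₅ × x₃ ≢ x₆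
  × x₄ ≢ x₅ × x₄ ≢ x₆
  × x₅ ≢ x₆
  × IsCycle (lookup 𝒞 i) x₁ x₂ x₃ x₄
  × IsCycle (lookup 𝒞 j) x₁ x₅ x₃ x₆ ))

DAvoiding : ∀ {v} → List (Cycle4 v) → Set
DAvoiding 𝒞 = ¬ DoubleDiamond 𝒞

StrictlySparse : ∀ {v} → ℕ → List (Cycle4 v) → Set
StrictlySparse r 𝒞 = Sparse r 𝒞 × DAvoiding 𝒞

-- For D-avoidance it suffices that no two distinct cycles share a diagonal,
-- which is a check over pairs of cycles and pairs of vertices rather than
-- over six-tuples of vertices.
module Submission where

open import Defs
open import Data.List using (List; []; _∷_; lookup)
open import Data.Product using (_×_; ∃-syntax; _,_)
open import Data.Nat using (suc; s≤s)
import Data.Nat.Properties as ℕ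
open import Data.Fin using (Fin; #_)
open import Data.Fin.Properties using (_≟_; all?)
open import Data.Fin.Subset using (∣_∣)
open import Data.Fin.Subset.Properties using (anySubset?)
open import Data.Sum using (_⊎_; inj₁; inj₂)
open import Data.List.Relation.Unary.Any using (here; there)
open import Relation.Binary.PropositionalEquality using (_≡_; _≢_; refl)
open import Relation.Nullary using (¬_; Dec; ¬?)
open import Relation.Nullary.Decidable
  using (True; toWitness; from-yes; from-no; _×-dec_; _⊎-dec_; _→-dec_)

cycle4 : ∀ {v} (p q r s : Fin v) →
         {True (¬? (p ≟ q) ×-dec ¬? (p ≟ r) ×-dec ¬? (p ≟ s) ×-dec
                ¬? (q ≟ r) ×-dec ¬? (q ≟ s) ×-dec ¬? (r ≟ s))} →
         Cycle4 v
cycle4 p q r s {distinct} with toWitness distinct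
... | p≢q , p≢r , p≢s , q≢r , q≢s , r≢s = cyc p q r s p≢q p≢r p≢s q≢r q≢s r≢s

is4CS? : ∀ v (𝒞 : List (Cycle4 v)) → Dec (Is4CS v 𝒞)
is4CS? v 𝒞 = all? λ x → all? λ y → ¬? (x ≟ y) →-dec (edgeMultiplicity 𝒞 x y ℕ.≟ 1)

configuration? : ∀ {v} (𝒞 : List (Cycle4 v)) k l → Dec (Configuration 𝒞 k l)
configuration? 𝒞 k l = anySubset? λ S → (∣ S ∣ ℕ.≟ l) ×-dec (∣ unionVertices 𝒞 S ∣ ℕ.≟ k)

sparse₄ : ∀ {v} {𝒞 : List (Cycle4 v)} →
          ¬ Configuration 𝒞 5 2 → ¬ Configuration 𝒞 6 3 → ¬ Configuration 𝒞 7 4 →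
          Sparse 4 𝒞
sparse₄ {𝒞 = 𝒞} no-5-2 no-6-3 no-7-4 = go
  where
  go : Sparse 4 𝒞
  go 2 _ _ = no-5-2
  go 3 _ _ = no-6-3
  go 4 _ _ = no-7-4
  go 0 () _
  go 1 (s≤s ()) _
  go (suc (suc (suc (suc (suc _))))) _ (s≤s (s≤s (s≤s (s≤s ()))))

Diagonal : ∀ {v} → Cycle4 v → Fin v → Fin v → Set
Diagonal C p r = ((p ≡ a C × r ≡ c C) ⊎ (p ≡ c C × r ≡ a C))
               ⊎ ((p ≡ b C × r ≡ d C) ⊎ (p ≡ d C × r ≡ b C))

diagonal? : ∀ {v} (C : Cycle4 v) p r → Dec (Diagonal C p r)
diagonal? C p r = (((p ≟ a C) ×-dec (r ≟ c C)) ⊎-dec ((p ≟ c C) ×-dec (r ≟ a C)))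
          ⊎-dec (((p ≟ b C) ×-dec (r ≟ d C)) ⊎-dec ((p ≟ d C) ×-dec (r ≟ b C)))

isCycle⇒diagonal : ∀ {v} (C : Cycle4 v) {p q r s} → IsCycle C p q r s → Diagonal C p r
isCycle⇒diagonal C (here refl) = inj₁ (inj₁ (refl , refl))
isCycle⇒diagonal C (there (here refl)) = inj₂ (inj₂ (refl , refl))
isCycle⇒diagonal C (there (there (here refl))) = inj₁ (inj₂ (refl , refl))
isCycle⇒diagonal C (there (there (there (here refl)))) = inj₂ (inj₁ (refl , refl))
isCycle⇒diagonal C (there (there (there (there (here refl))))) = inj₁ (inj₁ (refl , refl))
isCycle⇒diagonal C (there (there (there (there (there (here refl)))))) = inj₂ (inj₂ (refl , refl))
isCycle⇒diagonal C (there (there (there (there (there (there (here refl))))))) = inj₁ (inj₂ (refl , refl))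
isCycle⇒diagonal C (there (there (there (there (there (there (there (here refl)))))))) = inj₂ (inj₁ (refl , refl))

DiagonalsUnshared : ∀ {v} → List (Cycle4 v) → Set
DiagonalsUnshared 𝒞 = ∀ i j → i ≢ j → ∀ p r →
  Diagonal (lookup 𝒞 i) p r → ¬ Diagonal (lookup 𝒞 j) p r

diagonalsUnshared? : ∀ {v} (𝒞 : List (Cycle4 v)) → Dec (DiagonalsUnshared 𝒞)
diagonalsUnshared? 𝒞 = all? λ i → all? λ j → ¬? (i ≟ j) →-dec all? λ p → all? λ r →
  diagonal? (lookup 𝒞 i) p r →-dec ¬? (diagonal? (lookup 𝒞 j) p r)

diagonalsUnshared⇒DAvoiding : ∀ {v} {𝒞 : List (Cycle4 v)} →
                              DiagonalsUnshared 𝒞 → DAvoiding 𝒞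
diagonalsUnshared⇒DAvoiding {𝒞 = 𝒞} unshared
  (i , j , i≢j , x₁ , _ , x₃ , _ , _ , _ , _ , _ , _ , _ , _ , _ , _ , _ , _ , _ , _ , _ , _ , _ , _ , Cᵢ , Cⱼ) =
  unshared i j i≢j x₁ x₃ (isCycle⇒diagonal (lookup 𝒞 i) Cᵢ) (isCycle⇒diagonal (lookup 𝒞 j) Cⱼ)

system₉ : List (Cycle4 9)
system₉ =
  cycle4 (# 0) (# 1) (# 7) (# 5) ∷
  cycle4 (# 0) (# 2) (# 8) (# 4) ∷
  cycle4 (# 0) (# 3) (# 4) (# 7) ∷
  cycle4 (# 0) (# 6) (# 3) (# 8) ∷
  cycle4 (# 1) (# 2) (# 3) (# 5) ∷
  cycle4 (# 1) (# 3) (# 7) (# 8) ∷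
  cycle4 (# 1) (# 4) (# 2) (# 6) ∷
  cycle4 (# 2) (# 5) (# 6) (# 7) ∷
  cycle4 (# 4) (# 5) (# 8) (# 6) ∷
  []

lemma8 : ∃[ 𝒞 ] (Is4CS 9 𝒞 × StrictlySparse 4 𝒞)
lemma8 = system₉
       , from-yes (is4CS? 9 system₉)
       , sparse₄ (from-no (configuration? system₉ 5 2))
                 (from-no (configuration? system₉ 6 3))
                 (from-no (configuration? system₉ 7 4))
       , diagonalsUnshared⇒DAvoiding (from-yes (diagonalsUnshared? system₉))
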